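{- Let $G$ be a chordal graph, $T\subseteq V(G)$ and $k$ an integer. Let $t\in T$ be a simplicial vertex of $G$ whose simplicial clique is $C=\{t,x,y,z\}$ (four vertices). If there is a set $S\subseteq V(G)$ with $|S|\leq k$ such that $G-S$ has no $T$-cycle and $S$ contains two vertices of $C$, then there is a set $S'\subseteq V(G)$ with $|S'|\leq k$ such that $G-S'$ has no $T$-cycle and $t\notin S'$.
   Context: A graph is chordal if every cycle of length at least four has a chord. A $T$-cycle is a cycle containing a vertex of $T$. A vertex $v$ is simplicial if $N[v]$ is a clique; $N[v]$ is then its simplicial clique. -}

module Defs where

open import Data.Nat using (ℕ; zero; suc; _+_; _<_; _≤_)
open import Data.Fin using (Fin; toℕ; inject₁; fromℕ) renaming (zero to fzero; suc to fsuc)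
open import Data.Fin.Subset using (Subset; _∈_; _∉_)
open import Data.Product using (Σ; ∃; _×_; _,_)
open import Data.Sum using (_⊎_)
open import Relation.Nullary using (¬_; Dec)
open import Relation.Binary.PropositionalEquality using (_≡_; _≢_)
open import Function.Definitions using (Injective)

record Graph (n : ℕ) : Set₁ where
  field
    E      : Fin n → Fin n → Set
    sym    : ∀ {u v} → E u v → E v u
    irrefl : ∀ {u} → ¬ E u u
    dec    : ∀ u v → Dec (E u v)
open Graph public

-- A cycle of length (suc k) ≥ 3 in G: distinct vertices c 0, …, c k with
-- c i adjacent to c (i+1) and c k adjacent to c 0.
record Cycle {n : ℕ} (G : Graph n) : Set where
  field
    k      : ℕ
    len≥3  : 2 ≤ k
    vert   : Fin (suc k) → Fin n
    inj    : Injective _≡_ _≡_ vert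
    edge   : ∀ (i : Fin k) → E G (vert (inject₁ i)) (vert (fsuc i))
    close  : E G (vert (fromℕ k)) (vert fzero)
open Cycle public

length : ∀ {n} {G : Graph n} → Cycle G → ℕ
length C = suc (k C)

Consecutive : ∀ {m} → Fin (suc m) → Fin (suc m) → Set
Consecutive {m} i j = (suc (toℕ i) ≡ toℕ j) ⊎ (suc (toℕ j) ≡ toℕ i)
                      ⊎ ((toℕ i ≡ 0) × (toℕ j ≡ m)) ⊎ ((toℕ j ≡ 0) × (toℕ i ≡ m))

HasChord : ∀ {n} {G : Graph n} → Cycle G → Set
HasChord {G = G} C =
  Σ (Fin (suc (k C))) λ i → Σ (Fin (suc (k C))) λ j →
    i ≢ j × ¬ Consecutive i j × E G (vert C i) (vert C j)

Chordal : ∀ {n} → Graph n → Set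
Chordal G = ∀ (C : Cycle G) → 4 ≤ length C → HasChord C

-- the cycle avoids S, i.e. it is a cycle of G - S
Avoids : ∀ {n} {G : Graph n} → Cycle G → Subset n → Set
Avoids C S = ∀ i → vert C i ∉ S

IsTCycle : ∀ {n} {G : Graph n} → Subset n → Cycle G → Set
IsTCycle T C = ∃ λ i → vert C i ∈ T

NoTCycleAfterDeleting : ∀ {n} → Graph n → Subset n → Subset n → Set
NoTCycleAfterDeleting G T S = ∀ (C : Cycle G) → Avoids C S → ¬ IsTCycle T C

InClosedNbhd : ∀ {n} → Graph n → Fin n → Fin n → Set
InClosedNbhd G v u = (u ≡ v) ⊎ E G v u

Simplicial : ∀ {n} → Graph n → Fin n → Set
Simplicial G v = ∀ a b → InClosedNbhd G v a → InClosedNbhd G v b → a ≢ b → E G a b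

-- If S ∋ t already contains a further vertex u of N[t], replace t by a third vertex w of
-- N[t]. This does not increase |S|, and in G - S′ the vertex t keeps at most one neighbour,
-- the fourth vertex of N[t]; so t lies on no cycle of G - S′, every such cycle avoids S, and
-- none meets T.
module Submission where

open import Data.Nat using (ℕ; suc; _+_; _≤_; s≤s)
open import Data.Nat.Properties using (≤-refl; +-comm; +-suc; +-monoʳ-≤; n≤1+n; ≤-trans; module ≤-Reasoning)
open import Data.Fin using (Fin; toℕ; fromℕ; inject₁) renaming (zero to fzero; suc to fsuc)
open import Data.Fin.Properties using (toℕ-fromℕ; toℕ-inject₁)
open import Data.Fin.Relation.Unary.Top using (view; ‵fromℕ; ‵inject₁)
open import Data.Fin.Subset using (Subset; _∈_; _∉_; ∣_∣; inside; outside; _∪_; _─_; _-_; ⁅_⁆)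
open import Data.Fin.Subset.Properties
  using (_∈?_; ∣⁅x⁆∣≡1; x∈⁅x⁆; x∈⁅y⁆⇒x≡y; x∈p∪q⁺; x∈p∪q⁻; x∈p∧x≢y⇒x∈p-y; x∈p⇒∣p-x∣<∣p∣)
open import Data.Vec using (_∷_; []; here; there)
open import Data.Empty using (⊥-elim)
open import Data.Product using (Σ; ∃; ∃₂; _×_; _,_)
open import Data.Sum using (_⊎_; inj₁; inj₂)
open import Function using (_∘_)
open import Function.Bundles using (_⇔_; Equivalence)
open import Relation.Nullary using (yes; no)
open import Relation.Binary.PropositionalEquality using (_≡_; _≢_; refl; sym; trans; cong; subst)
open import Defs hiding (sym)

x∈p─q⇒x∉q : ∀ {n} {x : Fin n} (p q : Subset n) → x ∈ p ─ q → x ∉ q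
x∈p─q⇒x∉q (inside ∷ p) (outside ∷ q) here ()
x∈p─q⇒x∉q (_ ∷ p) (_ ∷ q) (there x∈p─q) (there x∈q) = x∈p─q⇒x∉q p q x∈p─q x∈q

x∉p-x : ∀ {n} (p : Subset n) x → x ∉ p - x
x∉p-x p x x∈p-x = x∈p─q⇒x∉q p ⁅ x ⁆ x∈p-x (x∈⁅x⁆ x)

∣p∪q∣≤∣p∣+∣q∣ : ∀ {n} (p q : Subset n) → ∣ p ∪ q ∣ ≤ ∣ p ∣ + ∣ q ∣
∣p∪q∣≤∣p∣+∣q∣ [] [] = ≤-refl
∣p∪q∣≤∣p∣+∣q∣ (outside ∷ p) (outside ∷ q) = ∣p∪q∣≤∣p∣+∣q∣ p q
∣p∪q∣≤∣p∣+∣q∣ (inside ∷ p) (outside ∷ q) = s≤s (∣p∪q∣≤∣p∣+∣q∣ p q)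
∣p∪q∣≤∣p∣+∣q∣ (outside ∷ p) (inside ∷ q) =
  subst (suc ∣ p ∪ q ∣ ≤_) (sym (+-suc ∣ p ∣ ∣ q ∣)) (s≤s (∣p∪q∣≤∣p∣+∣q∣ p q))
∣p∪q∣≤∣p∣+∣q∣ (inside ∷ p) (inside ∷ q) =
  s≤s (≤-trans (∣p∪q∣≤∣p∣+∣q∣ p q) (+-monoʳ-≤ ∣ p ∣ (n≤1+n ∣ q ∣)))

∣p-x∪⁅y⁆∣≤∣p∣ : ∀ {n} {p : Subset n} {x} y → x ∈ p → ∣ (p - x) ∪ ⁅ y ⁆ ∣ ≤ ∣ p ∣
∣p-x∪⁅y⁆∣≤∣p∣ {p = p} {x = x} y x∈p = begin
  ∣ (p - x) ∪ ⁅ y ⁆ ∣   ≤⟨ ∣p∪q∣≤∣p∣+∣q∣ (p - x) ⁅ y ⁆ ⟩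
  ∣ p - x ∣ + ∣ ⁅ y ⁆ ∣ ≡⟨ cong (∣ p - x ∣ +_) (∣⁅x⁆∣≡1 y) ⟩
  ∣ p - x ∣ + 1         ≡⟨ +-comm ∣ p - x ∣ 1 ⟩
  suc ∣ p - x ∣         ≤⟨ x∈p⇒∣p-x∣<∣p∣ x∈p ⟩
  ∣ p ∣                 ∎
  where open ≤-Reasoning

CyclicSucc : ℕ → ℕ → ℕ → Set
CyclicSucc m a b = b ≡ suc a ⊎ (a ≡ m × b ≡ 0)

cyclicSucc-twice-≢ : ∀ {m a b c} → 2 ≤ m → CyclicSucc m a b → CyclicSucc m b c → a ≢ c
cyclicSucc-twice-≢ _ (inj₁ refl) (inj₁ refl) ()
cyclicSucc-twice-≢ (s≤s (s≤s _)) (inj₁ refl) (inj₂ (refl , refl)) ()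
cyclicSucc-twice-≢ (s≤s (s≤s _)) (inj₂ (refl , refl)) (inj₁ refl) ()
cyclicSucc-twice-≢ (s≤s (s≤s _)) (inj₂ (refl , refl)) (inj₂ (() , _))

module _ {n} {G : Graph n} (C : Cycle G) where

  successor : ∀ p → ∃ λ s → E G (vert C p) (vert C s) × CyclicSucc (k C) (toℕ p) (toℕ s)
  successor p with view p
  ... | ‵fromℕ = fzero , close C , inj₂ (toℕ-fromℕ (k C) , refl)
  ... | ‵inject₁ i = fsuc i , edge C i , inj₁ (cong suc (sym (toℕ-inject₁ i)))

  predecessor : ∀ p → ∃ λ r → E G (vert C r) (vert C p) × CyclicSucc (k C) (toℕ r) (toℕ p)
  predecessor fzero = fromℕ (k C) , close C , inj₂ (toℕ-fromℕ (k C) , refl)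
  predecessor (fsuc i) = inject₁ i , edge C i , inj₁ (cong suc (sym (toℕ-inject₁ i)))

  two-distinct-neighbours : ∀ p → ∃₂ λ r s →
    E G (vert C p) (vert C r) × E G (vert C p) (vert C s) × vert C r ≢ vert C s
  two-distinct-neighbours p with predecessor p | successor p
  ... | r , r~p , r→p | s , p~s , p→s =
    r , s , Graph.sym G r~p , p~s , cyclicSucc-twice-≢ (len≥3 C) r→p p→s ∘ cong toℕ ∘ inj C

avoiding-cycle-misses : ∀ {n} {G : Graph n} {S : Subset n} {v c} →
  (∀ u → E G v u → u ∉ S → u ≡ c) → (C : Cycle G) → Avoids C S → ∀ p → vert C p ≢ v
avoiding-cycle-misses deg≤1 C avoids p refl with two-distinct-neighbours C p
... | r , s , p~r , p~s , r≢s = r≢s (trans (deg≤1 _ p~r (avoids r)) (sym (deg≤1 _ p~s (avoids s))))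

NoTCycleAfterDeleting-exchange : ∀ {n} {G : Graph n} {T S S′ : Subset n} {t} →
  NoTCycleAfterDeleting G T S → (∀ {v} → v ∈ S → v ≢ t → v ∈ S′) →
  (∀ (C : Cycle G) → Avoids C S′ → ∀ p → vert C p ≢ t) → NoTCycleAfterDeleting G T S′
NoTCycleAfterDeleting-exchange noS S∖t⊆S′ misses C avoids =
  noS C λ p v∈S → avoids p (S∖t⊆S′ v∈S (misses C avoids p))

exchange-for-neighbour : ∀ {n} {G : Graph n} {T S : Subset n} {t u w c} →
  NoTCycleAfterDeleting G T S → t ∈ S → u ∈ S → u ≢ t → w ≢ t →
  (∀ {v} → E G t v → v ≡ u ⊎ v ≡ w ⊎ v ≡ c) →
  ∣ (S - t) ∪ ⁅ w ⁆ ∣ ≤ ∣ S ∣ × NoTCycleAfterDeleting G T ((S - t) ∪ ⁅ w ⁆) × t ∉ (S - t) ∪ ⁅ w ⁆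
exchange-for-neighbour {G = G} {S = S} {t} {u} {w} {c} noS t∈S u∈S u≢t w≢t N⟨t⟩ =
  ∣p-x∪⁅y⁆∣≤∣p∣ w t∈S ,
  NoTCycleAfterDeleting-exchange noS S∖t⊆S′ (avoiding-cycle-misses t-leaf) ,
  t∉S′
  where
  S′ : Subset _
  S′ = (S - t) ∪ ⁅ w ⁆

  S∖t⊆S′ : ∀ {v} → v ∈ S → v ≢ t → v ∈ S′
  S∖t⊆S′ v∈S v≢t = x∈p∪q⁺ (inj₁ (x∈p∧x≢y⇒x∈p-y v∈S v≢t))

  w∈S′ : w ∈ S′
  w∈S′ = x∈p∪q⁺ (inj₂ (x∈⁅x⁆ w))

  t∉S′ : t ∉ S′
  t∉S′ t∈S′ with x∈p∪q⁻ (S - t) ⁅ w ⁆ t∈S′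
  ... | inj₁ t∈S-t = x∉p-x S t t∈S-t
  ... | inj₂ t∈⁅w⁆ = w≢t (sym (x∈⁅y⁆⇒x≡y w t∈⁅w⁆))

  t-leaf : ∀ v → E G t v → v ∉ S′ → v ≡ c
  t-leaf v t~v v∉S′ with N⟨t⟩ t~v
  ... | inj₁ refl = ⊥-elim (v∉S′ (S∖t⊆S′ u∈S u≢t))
  ... | inj₂ (inj₁ refl) = ⊥-elim (v∉S′ w∈S′)
  ... | inj₂ (inj₂ v≡c) = v≡c

open-neighbour : ∀ {n} {G : Graph n} {P : Fin n → Set} {t v} →
  (∀ v → InClosedNbhd G t v ⇔ (v ≡ t ⊎ P v)) → E G t v → P v
open-neighbour {G = G} N[t]⇔ t~v with Equivalence.to (N[t]⇔ _) (inj₂ t~v)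
... | inj₁ refl = ⊥-elim (irrefl G t~v)
... | inj₂ Pv = Pv

one-of-distinct-pair : ∀ {A : Set} {P R : A → Set} {t a b} →
  a ≢ b → a ≡ t ⊎ R a → b ≡ t ⊎ R b → P a → P b → ∃ λ u → R u × P u
one-of-distinct-pair _ (inj₂ Ra) _ Pa _ = _ , Ra , Pa
one-of-distinct-pair _ (inj₁ refl) (inj₂ Rb) _ Pb = _ , Rb , Pb
one-of-distinct-pair a≢b (inj₁ refl) (inj₁ refl) _ _ = ⊥-elim (a≢b refl)

one-of-three-≢ : ∀ {A : Set} {t x y z v : A} →
  t ≢ x → t ≢ y → t ≢ z → v ≡ x ⊎ v ≡ y ⊎ v ≡ z → v ≢ t
one-of-three-≢ t≢x _ _ (inj₁ refl) = t≢x ∘ sym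
one-of-three-≢ _ t≢y _ (inj₂ (inj₁ refl)) = t≢y ∘ sym
one-of-three-≢ _ _ t≢z (inj₂ (inj₂ refl)) = t≢z ∘ sym

other-two-of-three : ∀ {A : Set} {x y z u : A} → x ≢ y → x ≢ z → y ≢ z →
  u ≡ x ⊎ u ≡ y ⊎ u ≡ z →
  ∃₂ λ w c → w ≢ u × (w ≡ x ⊎ w ≡ y ⊎ w ≡ z) ×
    (∀ {v} → v ≡ x ⊎ v ≡ y ⊎ v ≡ z → v ≡ u ⊎ v ≡ w ⊎ v ≡ c)
other-two-of-three x≢y _ _ (inj₁ refl) = _ , _ , x≢y ∘ sym , inj₂ (inj₁ refl) ,
  λ { (inj₁ e) → inj₁ e ; (inj₂ (inj₁ e)) → inj₂ (inj₁ e) ; (inj₂ (inj₂ e)) → inj₂ (inj₂ e) }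
other-two-of-three x≢y _ _ (inj₂ (inj₁ refl)) = _ , _ , x≢y , inj₁ refl ,
  λ { (inj₁ e) → inj₂ (inj₁ e) ; (inj₂ (inj₁ e)) → inj₁ e ; (inj₂ (inj₂ e)) → inj₂ (inj₂ e) }
other-two-of-three _ x≢z _ (inj₂ (inj₂ refl)) = _ , _ , x≢z , inj₁ refl ,
  λ { (inj₁ e) → inj₂ (inj₁ e) ; (inj₂ (inj₁ e)) → inj₂ (inj₂ e) ; (inj₂ (inj₂ e)) → inj₁ e }

lemma32 : ∀ {n} (G : Graph n) (T : Subset n) (k : ℕ) (t x y z : Fin n) →
    Chordal G → t ∈ T → Simplicial G t →
    t ≢ x → t ≢ y → t ≢ z → x ≢ y → x ≢ z → y ≢ z →
    (∀ v → InClosedNbhd G t v ⇔ (v ≡ t ⊎ v ≡ x ⊎ v ≡ y ⊎ v ≡ z)) →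
    (Σ (Subset n) λ S → ∣ S ∣ ≤ k × NoTCycleAfterDeleting G T S ×
       (Σ (Fin n) λ a → Σ (Fin n) λ b → a ≢ b ×
          (a ≡ t ⊎ a ≡ x ⊎ a ≡ y ⊎ a ≡ z) × (b ≡ t ⊎ b ≡ x ⊎ b ≡ y ⊎ b ≡ z) ×
          a ∈ S × b ∈ S)) →
    Σ (Subset n) λ S′ → ∣ S′ ∣ ≤ k × NoTCycleAfterDeleting G T S′ × t ∉ S′
lemma32 G T k t x y z _ _ _ t≢x t≢y t≢z x≢y x≢z y≢z N[t]⇔
        (S , ∣S∣≤k , noS , a , b , a≢b , a∈C , b∈C , a∈S , b∈S) with t ∈? S
... | no t∉S = S , ∣S∣≤k , noS , t∉S
... | yes t∈S =
  let (u , u∈xyz , u∈S) = one-of-distinct-pair a≢b a∈C b∈C a∈S b∈S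
      (w , c , w≢u , w∈xyz , cover) = other-two-of-three x≢y x≢z y≢z u∈xyz
      (∣S′∣≤∣S∣ , noS′ , t∉S′) =
        exchange-for-neighbour noS t∈S u∈S (one-of-three-≢ t≢x t≢y t≢z u∈xyz)
          (one-of-three-≢ t≢x t≢y t≢z w∈xyz) (cover ∘ open-neighbour {G = G} N[t]⇔)
  in (S - t) ∪ ⁅ w ⁆ , ≤-trans ∣S′∣≤∣S∣ ∣S∣≤k , noS′ , t∉S′
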